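{- The set $\mathscr{C}=\bigcup_{L\ge1}\mathscr{C}^{(L)}$, equipped with the operations $(M,\mu)_{/\pi}=(P_\pi M,P_\pi\mu)$ for $\pi:[L]\to[L']$, is a minion; in particular $(M,\mu)_{/\pi}\in\mathscr{C}^{(L')}$ whenever $(M,\mu)\in\mathscr{C}^{(L)}$.
   Context: For $\pi:[L]\to[L']$, $P_\pi$ is the $L'\times L$ matrix whose $(i,j)$ entry is $1$ if $\pi(j)=i$ and $0$ otherwise. A $p\times\aleph_0$ matrix (rows indexed by $[p]$, columns by $\mathbb{N}$) $M$ is skeletal if for each $j\in[p]$ either the $j$-th row of $M$ is zero or $Me_i=e_j$ (the $j$-th standard unit vector) for some $i\in\mathbb{N}$. $\mathscr{C}^{(L)}$ is the set of pairs $(M,\mu)$ with $M\in\mathbb{Q}^{L\times\aleph_0}$ and $\mu\in\mathbb{Z}^L$ such that: $M$ is entrywise nonnegative; every column of $M$ has entries summing to $1$; the entries of $\mu$ sum to $1$; $\mathrm{supp}(\mu)\subseteq\mathrm{supp}(Me_1)$ (support = set of indices of nonzero entries); there is $t\in\mathbb{N}$ with $Me_i=Me_t$ for all $i\ge t$; $M$ is skeletal. A minion is a disjoint union of sets $\mathscr{M}^{(L)}$, $L\in\mathbb{N}$, with maps $(\cdot)_{/\pi}:\mathscr{M}^{(L)}\to\mathscr{M}^{(L')}$ for all $\pi:[L]\to[L']$ such that $(M_{/\pi})_{/\tilde\pi}=M_{/\tilde\pi\circ\pi}$ and $M_{/\mathrm{id}}=M$. -}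

module Defs where

open import Data.Nat using (ℕ; _≥_)
open import Data.Fin using (Fin; zero; suc; _≟_)
open import Data.Rational using (ℚ; 0ℚ; 1ℚ; _≤_) renaming (_+_ to _+ℚ_)
open import Data.Integer using (ℤ; +_) renaming (_+_ to _+ℤ_)
open import Data.Bool using (if_then_else_)
open import Data.Product using (Σ; ∃; _×_)
open import Data.Sum using (_⊎_)
open import Relation.Nullary using (¬_; does)
open import Relation.Binary.PropositionalEquality using (_≡_; _≢_)

-- [L] is Fin L.  A p × ℵ₀ matrix is a function Fin p → ℕ → A
-- (row index, column index); column 0 plays the role of the paper's e₁.

ℚMat : ℕ → Set
ℚMat L = Fin L → ℕ → ℚ

ℤVec : ℕ → Set
ℤVec L = Fin L → ℤ

sumℚ : ∀ {n} → (Fin n → ℚ) → ℚ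
sumℚ {ℕ.zero}  f = 0ℚ
sumℚ {ℕ.suc n} f = f zero +ℚ sumℚ (λ j → f (suc j))

sumℤ : ∀ {n} → (Fin n → ℤ) → ℤ
sumℤ {ℕ.zero}  f = + 0
sumℤ {ℕ.suc n} f = f zero +ℤ sumℤ (λ j → f (suc j))

PπM : ∀ {L L'} → (Fin L → Fin L') → ℚMat L → ℚMat L'
PπM π M i k = sumℚ (λ j → if does (π j ≟ i) then M j k else 0ℚ)

Pπμ : ∀ {L L'} → (Fin L → Fin L') → ℤVec L → ℤVec L'
Pπμ π μ i = sumℤ (λ j → if does (π j ≟ i) then μ j else + 0)

unitℚ : ∀ {L} → Fin L → Fin L → ℚ
unitℚ j r = if does (r ≟ j) then 1ℚ else 0ℚ

Skeletal : ∀ {p} → ℚMat p → Set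
Skeletal {p} M = (j : Fin p) →
  ((i : ℕ) → M j i ≡ 0ℚ) ⊎ (Σ ℕ λ i → (r : Fin p) → M r i ≡ unitℚ j r)

record InC (L : ℕ) (M : ℚMat L) (μ : ℤVec L) : Set where
  field
    nonneg     : (r : Fin L) (i : ℕ) → 0ℚ ≤ M r i
    colSum     : (i : ℕ) → sumℚ (λ r → M r i) ≡ 1ℚ
    μSum       : sumℤ μ ≡ + 1
    support    : (r : Fin L) → μ r ≢ + 0 → M r 0 ≢ 0ℚ
    eventually : Σ ℕ λ t → (i : ℕ) → i ≥ t → (r : Fin L) → M r i ≡ M r t
    skeletal   : Skeletal M

module Submission where

-- Multiplying by P_π pushes each column of M (and μ) forward along π,
-- summing the entries over each fibre of π.
-- Row j of P_π M is the sum of the rows of M in the fibre of j: either all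
-- of them vanish, or one of them, r, is nonzero, and then skeletality of M
-- gives a column e_r of M, which P_π sends to e_{π r} = e_j.  If an entry
-- of P_π M e₁ vanishes, it is a sum of nonnegative terms, so the entries
-- of M e₁ over that fibre vanish, hence so do those of μ and of P_π μ.

open import Defs
open import Algebra.Bundles using (CommutativeMonoid)
import Algebra.Properties.CommutativeMonoid.Sum as CommutativeMonoidSum
open import Data.Bool using (true; false; if_then_else_)
open import Data.Bool.Properties using (if-swap-then)
open import Data.Empty using (⊥-elim)
open import Data.Fin using (Fin; zero; suc; _≟_)
open import Data.Integer using (ℤ; +_) renaming (_+_ to _+ℤ_)
import Data.Integer as ℤ
import Data.Integer.Properties as ℤₚ
open import Data.Nat using (ℕ; _≥_)
open import Data.Product using (Σ; ∃; _×_; _,_)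
open import Data.Rational using (ℚ; 0ℚ; 1ℚ; _≤_) renaming (_+_ to _+ℚ_)
import Data.Rational.Properties as ℚₚ
open import Data.Sum using (_⊎_; inj₁; inj₂)
open import Function using (_∘_; id)
open import Relation.Binary.PropositionalEquality
  using (_≡_; _≢_; _≗_; refl; sym; trans; cong; subst; module ≡-Reasoning)
open import Relation.Nullary using (does; yes; no)
open import Relation.Nullary.Decidable using (dec-true; dec-false; decidable-stable)

∀⊎∃ : ∀ {n} {P Q : Fin n → Set} → (∀ r → P r ⊎ Q r) → (∀ r → P r) ⊎ ∃ Q
∀⊎∃ {ℕ.zero}  _   = inj₁ λ ()
∀⊎∃ {ℕ.suc n} p⊎q with p⊎q zero | ∀⊎∃ (p⊎q ∘ suc)
... | inj₂ q₀ | _            = inj₂ (zero , q₀)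
... | inj₁ _  | inj₂ (r , q) = inj₂ (suc r , q)
... | inj₁ p₀ | inj₁ p       = inj₁ λ { zero → p₀ ; (suc r) → p r }

does-≟-sym : ∀ {n} (a b : Fin n) → does (a ≟ b) ≡ does (b ≟ a)
does-≟-sym a b with a ≟ b
... | yes a≡b = sym (dec-true (b ≟ a) (sym a≡b))
... | no  a≢b = sym (dec-false (b ≟ a) (a≢b ∘ sym))

module Pushforward {c ℓ} (𝕄 : CommutativeMonoid c ℓ) where

  open CommutativeMonoid 𝕄 renaming
    (Carrier to A; ε to 0#; ∙-congˡ to +-congˡ;
     identityˡ to +-identityˡ; identityʳ to +-identityʳ;
     refl to ≈-refl; sym to ≈-sym; trans to ≈-trans)
  open CommutativeMonoidSum 𝕄 public using (sum; sum-cong-≗)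
  open CommutativeMonoidSum 𝕄 using (sum-syntax; ∑-comm; sum-cong-≋; sum-replicate-zero)
  open import Relation.Binary.Reasoning.Setoid setoid

  pushforward : ∀ {L L'} → (Fin L → Fin L') → (Fin L → A) → Fin L' → A
  pushforward {L} π f i = ∑[ j < L ] (if does (π j ≟ i) then f j else 0#)

  ∑-select : ∀ {n} (a : Fin n) (f : Fin n → A) →
             ∑[ j < n ] (if does (j ≟ a) then f j else 0#) ≈ f a
  ∑-select {ℕ.suc n} zero    f = ≈-trans (+-congˡ (sum-replicate-zero n)) (+-identityʳ (f zero))
  ∑-select {ℕ.suc n} (suc a) f = ≈-trans (+-identityˡ _) (∑-select a (f ∘ suc))

  ∑-select′ : ∀ {n} (a : Fin n) (f : Fin n → A) →
              ∑[ j < n ] (if does (a ≟ j) then f j else 0#) ≈ f a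
  ∑-select′ a f = ≈-trans
    (reflexive (sum-cong-≗ λ j → cong (λ b → if b then f j else 0#) (does-≟-sym a j)))
    (∑-select a f)

  if-∑ : ∀ {n} b (h : Fin n → A) →
         (if b then ∑[ j < n ] h j else 0#) ≈ ∑[ j < n ] (if b then h j else 0#)
  if-∑ true  h = ≈-refl
  if-∑ {n} false h = ≈-sym (sum-replicate-zero n)

  pushforward-cong : ∀ {L L'} (π : Fin L → Fin L') {f g : Fin L → A} →
                     f ≗ g → pushforward π f ≗ pushforward π g
  pushforward-cong π f≗g i = sum-cong-≗ λ j → cong (λ x → if does (π j ≟ i) then x else 0#) (f≗g j)

  ∑-pushforward : ∀ {L L'} (π : Fin L → Fin L') (f : Fin L → A) →
                  ∑[ i < L' ] pushforward π f i ≈ ∑[ j < L ] f j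
  ∑-pushforward π f = ≈-trans (∑-comm (λ i j → if does (π j ≟ i) then f j else 0#))
    (sum-cong-≋ λ j → ∑-select′ (π j) (λ _ → f j))

  pushforward-zero : ∀ {L L'} (π : Fin L → Fin L') (f : Fin L → A) i →
                     (∀ j → π j ≡ i → f j ≈ 0#) → pushforward π f i ≈ 0#
  pushforward-zero {L} π f i fibre≈0 = ≈-trans (sum-cong-≋ term≈0) (sum-replicate-zero L)
    where
    term≈0 : ∀ j → (if does (π j ≟ i) then f j else 0#) ≈ 0#
    term≈0 j with π j ≟ i
    ... | yes πj≡i = fibre≈0 j πj≡i
    ... | no  _    = ≈-refl

  pushforward-single : ∀ {L L'} (π : Fin L → Fin L') (a : Fin L) (x : A) s →
                       pushforward π (λ b → if does (b ≟ a) then x else 0#) s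
                         ≈ (if does (s ≟ π a) then x else 0#)
  pushforward-single π a x s = begin
    pushforward π (λ b → if does (b ≟ a) then x else 0#) s
      ≡⟨ sum-cong-≗ (λ b → if-swap-then (does (π b ≟ s)) (does (b ≟ a))) ⟩
    sum (λ b → if does (b ≟ a) then (if does (π b ≟ s) then x else 0#) else 0#)
      ≈⟨ ∑-select a _ ⟩
    (if does (π a ≟ s) then x else 0#)
      ≡⟨ cong (λ b → if b then x else 0#) (does-≟-sym (π a) s) ⟩
    (if does (s ≟ π a) then x else 0#) ∎

  pushforward-id : ∀ {L} (f : Fin L → A) i → pushforward id f i ≈ f i
  pushforward-id f i = ∑-select i f

  pushforward-∘ : ∀ {L L' L''} (π : Fin L → Fin L') (π' : Fin L' → Fin L'') (f : Fin L → A) i →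
                  pushforward π' (pushforward π f) i ≈ pushforward (π' ∘ π) f i
  pushforward-∘ {L} {L'} π π' f i = begin
    ∑[ i' < L' ] (if does (π' i' ≟ i) then ∑[ j < L ] (if does (π j ≟ i') then f j else 0#) else 0#)
      ≈⟨ sum-cong-≋ (λ i' → if-∑ (does (π' i' ≟ i)) (λ j → if does (π j ≟ i') then f j else 0#)) ⟩
    ∑[ i' < L' ] ∑[ j < L ] (if does (π' i' ≟ i) then (if does (π j ≟ i') then f j else 0#) else 0#)
      ≈⟨ ∑-comm (λ i' j → if does (π' i' ≟ i) then (if does (π j ≟ i') then f j else 0#) else 0#) ⟩
    ∑[ j < L ] ∑[ i' < L' ] (if does (π' i' ≟ i) then (if does (π j ≟ i') then f j else 0#) else 0#)
      ≡⟨ sum-cong-≗ (λ j → sum-cong-≗ (λ i' → if-swap-then (does (π' i' ≟ i)) (does (π j ≟ i')))) ⟩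
    ∑[ j < L ] ∑[ i' < L' ] (if does (π j ≟ i') then (if does (π' i' ≟ i) then f j else 0#) else 0#)
      ≈⟨ sum-cong-≋ (λ j → ∑-select′ (π j) (λ i' → if does (π' i' ≟ i) then f j else 0#)) ⟩
    pushforward (π' ∘ π) f i ∎

module Pushℚ = Pushforward ℚₚ.+-0-commutativeMonoid
module Pushℤ = Pushforward ℤₚ.+-0-commutativeMonoid

open Pushℚ using (pushforward)

sumℚ≡sum : ∀ {n} (f : Fin n → ℚ) → sumℚ f ≡ Pushℚ.sum f
sumℚ≡sum {ℕ.zero}  f = refl
sumℚ≡sum {ℕ.suc n} f = cong (f zero +ℚ_) (sumℚ≡sum (f ∘ suc))

sumℤ≡sum : ∀ {n} (f : Fin n → ℤ) → sumℤ f ≡ Pushℤ.sum f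
sumℤ≡sum {ℕ.zero}  f = refl
sumℤ≡sum {ℕ.suc n} f = cong (f zero +ℤ_) (sumℤ≡sum (f ∘ suc))

PπM≡pushforward : ∀ {L L'} (π : Fin L → Fin L') (M : ℚMat L) i k →
                  PπM π M i k ≡ pushforward π (λ j → M j k) i
PπM≡pushforward π M i k = sumℚ≡sum (λ j → if does (π j ≟ i) then M j k else 0ℚ)

Pπμ≡pushforward : ∀ {L L'} (π : Fin L → Fin L') (μ : ℤVec L) i →
                  Pπμ π μ i ≡ Pushℤ.pushforward π μ i
Pπμ≡pushforward π μ i = sumℤ≡sum (λ j → if does (π j ≟ i) then μ j else + 0)

if-nonneg : ∀ b {x} → 0ℚ ≤ x → 0ℚ ≤ (if b then x else 0ℚ)
if-nonneg true  0≤x = 0≤x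
if-nonneg false _   = ℚₚ.≤-refl

+-nonneg-≡0ˡ : ∀ {p q} → 0ℚ ≤ p → 0ℚ ≤ q → p +ℚ q ≡ 0ℚ → p ≡ 0ℚ
+-nonneg-≡0ˡ {p} {q} 0≤p 0≤q p+q≡0 = ℚₚ.≤-antisym p≤0 0≤p
  where
  open ℚₚ.≤-Reasoning
  p≤0 : p ≤ 0ℚ
  p≤0 = begin
    p        ≡⟨ ℚₚ.+-identityʳ p ⟨
    p +ℚ 0ℚ  ≤⟨ ℚₚ.+-monoʳ-≤ p 0≤q ⟩
    p +ℚ q   ≡⟨ p+q≡0 ⟩
    0ℚ       ∎

∑-nonneg : ∀ {n} (f : Fin n → ℚ) → (∀ j → 0ℚ ≤ f j) → 0ℚ ≤ Pushℚ.sum f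
∑-nonneg {ℕ.zero}  f 0≤f = ℚₚ.≤-refl
∑-nonneg {ℕ.suc n} f 0≤f = ℚₚ.+-mono-≤ (0≤f zero) (∑-nonneg (f ∘ suc) (0≤f ∘ suc))

∑-nonneg-≡0 : ∀ {n} (f : Fin n → ℚ) → (∀ j → 0ℚ ≤ f j) → Pushℚ.sum f ≡ 0ℚ → ∀ j → f j ≡ 0ℚ
∑-nonneg-≡0 f 0≤f ∑f≡0 zero    = +-nonneg-≡0ˡ (0≤f zero) (∑-nonneg (f ∘ suc) (0≤f ∘ suc)) ∑f≡0
∑-nonneg-≡0 f 0≤f ∑f≡0 (suc j) = ∑-nonneg-≡0 (f ∘ suc) (0≤f ∘ suc) ∑tail≡0 j
  where
  ∑tail≡0 : Pushℚ.sum (f ∘ suc) ≡ 0ℚ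
  ∑tail≡0 = +-nonneg-≡0ˡ (∑-nonneg (f ∘ suc) (0≤f ∘ suc)) (0≤f zero)
              (trans (ℚₚ.+-comm _ (f zero)) ∑f≡0)

pushforward-nonneg : ∀ {L L'} (π : Fin L → Fin L') (f : Fin L → ℚ) →
                     (∀ j → 0ℚ ≤ f j) → ∀ i → 0ℚ ≤ pushforward π f i
pushforward-nonneg π f 0≤f i = ∑-nonneg _ λ j → if-nonneg (does (π j ≟ i)) (0≤f j)

pushforward-nonneg-≡0 : ∀ {L L'} (π : Fin L → Fin L') (f : Fin L → ℚ) →
                        (∀ j → 0ℚ ≤ f j) → ∀ i → pushforward π f i ≡ 0ℚ →
                        ∀ j → π j ≡ i → f j ≡ 0ℚ
pushforward-nonneg-≡0 π f 0≤f i push≡0 j πj≡i =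
  subst (λ b → (if b then f j else 0ℚ) ≡ 0ℚ) (dec-true (π j ≟ i) πj≡i)
    (∑-nonneg-≡0 _ (λ j′ → if-nonneg (does (π j′ ≟ i)) (0≤f j′)) push≡0 j)

module _ {L L'} (π : Fin L → Fin L') where

  PπM-nonneg : ∀ {M} → (∀ r i → 0ℚ ≤ M r i) → ∀ r i → 0ℚ ≤ PπM π M r i
  PπM-nonneg {M} 0≤M r i =
    subst (0ℚ ≤_) (sym (PπM≡pushforward π M r i)) (pushforward-nonneg π _ (λ j → 0≤M j i) r)

  PπM-colSum : ∀ M i → sumℚ (λ r → PπM π M r i) ≡ sumℚ (λ j → M j i)
  PπM-colSum M i = begin
    sumℚ (λ r → PπM π M r i)              ≡⟨ sumℚ≡sum (λ r → PπM π M r i) ⟩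
    Pushℚ.sum (λ r → PπM π M r i)         ≡⟨ Pushℚ.sum-cong-≗ (λ r → PπM≡pushforward π M r i) ⟩
    Pushℚ.sum (pushforward π (λ j → M j i)) ≡⟨ Pushℚ.∑-pushforward π _ ⟩
    Pushℚ.sum (λ j → M j i)               ≡⟨ sumℚ≡sum (λ j → M j i) ⟨
    sumℚ (λ j → M j i)                    ∎
    where open ≡-Reasoning

  Pπμ-sum : ∀ μ → sumℤ (Pπμ π μ) ≡ sumℤ μ
  Pπμ-sum μ = begin
    sumℤ (Pπμ π μ)                  ≡⟨ sumℤ≡sum (Pπμ π μ) ⟩
    Pushℤ.sum (Pπμ π μ)             ≡⟨ Pushℤ.sum-cong-≗ (Pπμ≡pushforward π μ) ⟩
    Pushℤ.sum (Pushℤ.pushforward π μ) ≡⟨ Pushℤ.∑-pushforward π μ ⟩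
    Pushℤ.sum μ                     ≡⟨ sumℤ≡sum μ ⟨
    sumℤ μ                          ∎
    where open ≡-Reasoning

  Pπ-support : ∀ {M μ} → (∀ r i → 0ℚ ≤ M r i) → (∀ r → μ r ≢ + 0 → M r 0 ≢ 0ℚ) →
               ∀ r → Pπμ π μ r ≢ + 0 → PπM π M r 0 ≢ 0ℚ
  Pπ-support {M} {μ} 0≤M supp r Pπμr≢0 PπMr0≡0 =
    Pπμr≢0 (trans (Pπμ≡pushforward π μ r) (Pushℤ.pushforward-zero π μ r μ≡0))
    where
    M0≡0 : ∀ j → π j ≡ r → M j 0 ≡ 0ℚ
    M0≡0 = pushforward-nonneg-≡0 π _ (λ j → 0≤M j 0) r
             (trans (sym (PπM≡pushforward π M r 0)) PπMr0≡0)
    μ≡0 : ∀ j → π j ≡ r → μ j ≡ + 0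
    μ≡0 j πj≡r = decidable-stable (μ j ℤ.≟ + 0) λ μj≢0 → supp j μj≢0 (M0≡0 j πj≡r)

  PπM-eventually : ∀ {M} → Σ ℕ (λ t → ∀ i → i ≥ t → ∀ r → M r i ≡ M r t) →
                   Σ ℕ (λ t → ∀ i → i ≥ t → ∀ r → PπM π M r i ≡ PπM π M r t)
  PπM-eventually {M} (t , stable) = t , λ i i≥t r → begin
    PπM π M r i                    ≡⟨ PπM≡pushforward π M r i ⟩
    pushforward π (λ j → M j i) r  ≡⟨ Pushℚ.pushforward-cong π (λ j → stable i i≥t j) r ⟩
    pushforward π (λ j → M j t) r  ≡⟨ PπM≡pushforward π M r t ⟨
    PπM π M r t                    ∎
    where open ≡-Reasoning

  PπM-skeletal : ∀ {M} → Skeletal M → Skeletal (PπM π M)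
  PπM-skeletal {M} skeletal j with ∀⊎∃ fibre-row-zero-or-unit
    where
    fibre-row-zero-or-unit : ∀ r → (π r ≡ j → ∀ i → M r i ≡ 0ℚ)
                                 ⊎ (π r ≡ j × Σ ℕ λ i → ∀ s → M s i ≡ unitℚ r s)
    fibre-row-zero-or-unit r with π r ≟ j | skeletal r
    ... | no πr≢j  | _                = inj₁ (⊥-elim ∘ πr≢j)
    ... | yes _    | inj₁ row-zero    = inj₁ λ _ → row-zero
    ... | yes πr≡j | inj₂ unit-column = inj₂ (πr≡j , unit-column)
  ... | inj₁ fibre-zero = inj₁ λ i →
    trans (PπM≡pushforward π M j i) (Pushℚ.pushforward-zero π _ j λ r πr≡j → fibre-zero r πr≡j i)
  ... | inj₂ (r , πr≡j , i , Meᵢ≡eᵣ) = inj₂ (i , λ s → begin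
    PπM π M s i                    ≡⟨ PπM≡pushforward π M s i ⟩
    pushforward π (λ r′ → M r′ i) s ≡⟨ Pushℚ.pushforward-cong π Meᵢ≡eᵣ s ⟩
    pushforward π (unitℚ r) s      ≡⟨ Pushℚ.pushforward-single π r 1ℚ s ⟩
    unitℚ (π r) s                  ≡⟨ cong (λ a → unitℚ a s) πr≡j ⟩
    unitℚ j s                      ∎)
    where open ≡-Reasoning

  InC-Pπ : ∀ {M μ} → InC L M μ → InC L' (PπM π M) (Pπμ π μ)
  InC-Pπ {M} {μ} M,μ∈C = record
    { nonneg     = PπM-nonneg nonneg
    ; colSum     = λ i → trans (PπM-colSum M i) (colSum i)
    ; μSum       = trans (Pπμ-sum μ) μSum
    ; support    = Pπ-support nonneg support
    ; eventually = PπM-eventually eventually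
    ; skeletal   = PπM-skeletal skeletal
    }
    where open InC M,μ∈C

PπM-∘ : ∀ {L L' L''} (π : Fin L → Fin L') (π' : Fin L' → Fin L'') (M : ℚMat L) i k →
        PπM π' (PπM π M) i k ≡ PπM (π' ∘ π) M i k
PπM-∘ π π' M i k = begin
  PπM π' (PπM π M) i k                            ≡⟨ PπM≡pushforward π' (PπM π M) i k ⟩
  pushforward π' (λ j → PπM π M j k) i            ≡⟨ Pushℚ.pushforward-cong π' (λ j → PπM≡pushforward π M j k) i ⟩
  pushforward π' (pushforward π (λ j → M j k)) i  ≡⟨ Pushℚ.pushforward-∘ π π' (λ j → M j k) i ⟩
  pushforward (π' ∘ π) (λ j → M j k) i            ≡⟨ PπM≡pushforward (π' ∘ π) M i k ⟨
  PπM (π' ∘ π) M i k                              ∎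
  where open ≡-Reasoning

Pπμ-∘ : ∀ {L L' L''} (π : Fin L → Fin L') (π' : Fin L' → Fin L'') (μ : ℤVec L) i →
        Pπμ π' (Pπμ π μ) i ≡ Pπμ (π' ∘ π) μ i
Pπμ-∘ π π' μ i = begin
  Pπμ π' (Pπμ π μ) i                                ≡⟨ Pπμ≡pushforward π' (Pπμ π μ) i ⟩
  Pushℤ.pushforward π' (Pπμ π μ) i                  ≡⟨ Pushℤ.pushforward-cong π' (Pπμ≡pushforward π μ) i ⟩
  Pushℤ.pushforward π' (Pushℤ.pushforward π μ) i    ≡⟨ Pushℤ.pushforward-∘ π π' μ i ⟩
  Pushℤ.pushforward (π' ∘ π) μ i                    ≡⟨ Pπμ≡pushforward (π' ∘ π) μ i ⟨
  Pπμ (π' ∘ π) μ i                                  ∎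
  where open ≡-Reasoning

PπM-id : ∀ {L} (M : ℚMat L) i k → PπM id M i k ≡ M i k
PπM-id M i k = trans (PπM≡pushforward id M i k) (Pushℚ.pushforward-id (λ j → M j k) i)

Pπμ-id : ∀ {L} (μ : ℤVec L) i → Pπμ id μ i ≡ μ i
Pπμ-id μ i = trans (Pπμ≡pushforward id μ i) (Pushℤ.pushforward-id μ i)

proposition4p4 :
    ((L L' : ℕ) (π : Fin L → Fin L') (M : ℚMat L) (μ : ℤVec L) →
      InC L M μ → InC L' (PπM π M) (Pπμ π μ))
    × ((L L' L'' : ℕ) (π : Fin L → Fin L') (π' : Fin L' → Fin L'') (M : ℚMat L) (μ : ℤVec L) →
      InC L M μ →
      ((i : Fin L'') (k : ℕ) → PπM π' (PπM π M) i k ≡ PπM (π' ∘ π) M i k)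
      × ((i : Fin L'') → Pπμ π' (Pπμ π μ) i ≡ Pπμ (π' ∘ π) μ i))
    × ((L : ℕ) (M : ℚMat L) (μ : ℤVec L) → InC L M μ →
      ((i : Fin L) (k : ℕ) → PπM id M i k ≡ M i k)
      × ((i : Fin L) → Pπμ id μ i ≡ μ i))
proposition4p4 =
    (λ L L' π M μ → InC-Pπ π)
  , (λ L L' L'' π π' M μ _ → PπM-∘ π π' M , Pπμ-∘ π π' μ)
  , (λ L M μ _ → PπM-id M , Pπμ-id μ)
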